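{- Let $n\ge 2$ and $p\in S_n$. Then $|D_1(p)|=n$ (the maximum possible number of $(n-1)$-patterns) if and only if $p$ contains no bonds.
   Context: Permutations $p=p_1\ldots p_n\in S_n$ are in one-line notation. $D_1(p)$ denotes the set of permutations in $S_{n-1}$ obtained from $p$ by deleting one entry and relabelling the remaining entries $1$ through $n-1$ preserving relative order. A bond of $p$ is a pair of adjacent entries $(p_i,p_{i+1})$ with $p_i-p_{i+1}=\pm1$. -}

module Defs where

open import Data.Nat using (ℕ; zero; suc; _<ᵇ_; _∸_; _+_)
open import Data.Bool using (if_then_else_)
open import Data.Fin using (Fin; toℕ)
open import Data.Fin.Permutation using (Permutation′; _⟨$⟩ʳ_)
open import Data.List using (List; []; _∷_; map; length; allFin; deduplicate)
open import Data.List.Properties using (≡-dec)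
open import Data.Nat.Properties using (_≟_)
open import Data.Product using (∃; _×_; _,_)
open import Data.Sum using (_⊎_)
open import Relation.Binary.PropositionalEquality using (_≡_)

-- A permutation p ∈ S_n; values are 0..n-1 (0-based relabelling of 1..n).
S : ℕ → Set
S n = Permutation′ n

oneLine : ∀ {n} → S n → List ℕ
oneLine {n} p = map (λ i → toℕ (p ⟨$⟩ʳ i)) (allFin n)

dropAt : ℕ → List ℕ → List ℕ
dropAt _       []       = []
dropAt zero    (x ∷ xs) = xs
dropAt (suc k) (x ∷ xs) = x ∷ dropAt k xs

-- Relabel after deleting the value v: entries above v drop by one
-- (preserves relative order; the remaining values are {0..n-1} \ {v},
-- so this yields values 0..n-2, i.e. the standardisation).
relabel : ℕ → ℕ → ℕ
relabel v x = if x <ᵇ v then x else x ∸ 1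

deleteEntry : ∀ {n} → S n → Fin n → List ℕ
deleteEntry p i = map (relabel (toℕ (p ⟨$⟩ʳ i))) (dropAt (toℕ i) (oneLine p))

D₁ : ∀ {n} → S n → List (List ℕ)
D₁ {n} p = deduplicate (≡-dec _≟_) (map (deleteEntry p) (allFin n))

HasBond : ∀ {n} → S n → Set
HasBond {n} p =
  ∃ λ (i : Fin n) → ∃ λ (j : Fin n) →
    (toℕ j ≡ suc (toℕ i)) ×
    ((toℕ (p ⟨$⟩ʳ j) ≡ suc (toℕ (p ⟨$⟩ʳ i))) ⊎ (toℕ (p ⟨$⟩ʳ i) ≡ suc (toℕ (p ⟨$⟩ʳ j))))

-- Deleting position i from p yields the list k ↦ relabel pᵢ (p (punchIn i k)).
-- For i < j the two deletions agree away from position i, where they read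
-- the relabelled p_{i+1} and p_i; so coinciding deletions force |p_{i+1} − p_i| = 1.
-- Conversely, across a bond the two neighbouring deletions give the same
-- pattern. Hence |D₁(p)| = n exactly when deleteEntry p is injective,
-- exactly when p has no bond.
module Submission where

open import Defs
open import Data.Nat using (ℕ; zero; suc; _≤_; _<_; _<ᵇ_; _∸_; s≤s)
open import Data.Nat.Properties using (_≟_; <-cmp; <-irrefl; <⇒≤; <⇒<ᵇ; <ᵇ⇒<; <⇒≱; m<n⇒m<1+n; n≤1+n; n<1+n; suc-injective; ≤-antisym)
open import Data.Bool using (true; false; T)
open import Data.Unit using (tt)
open import Data.Fin using (Fin; toℕ; punchIn)
open import Data.Fin.Properties using (toℕ-injective; punchInᵢ≢i)
open import Data.Fin.Permutation using (_⟨$⟩ʳ_)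
open import Data.List using (List; []; _∷_; map; length; allFin; deduplicate; filter; tabulate)
open import Data.List.Properties using (≡-dec; length-deduplicate; length-filter; filter-complete; filter-all; map-tabulate; length-tabulate; tabulate-cong)
open import Data.List.Relation.Binary.Equality.Propositional using (≡⇒≋; tabulate⁻)
open import Data.List.Relation.Unary.All as All using ()
open import Data.List.Relation.Unary.All.Properties as Allₚ using ()
open import Data.List.Relation.Unary.AllPairs using ([]; _∷_)
open import Data.List.Relation.Unary.Unique.Propositional using (Unique)
open import Data.List.Relation.Unary.Unique.Propositional.Properties using (tabulate⁺)
open import Data.List.Membership.Propositional using (_∈_)
open import Data.List.Membership.Propositional.Properties using (∈-deduplicate⁺; ∈-filter⁻)
open import Data.Product using (∃; _×_; _,_; proj₂)
open import Data.Sum using (_⊎_; inj₁; inj₂) renaming (map to ⊎-map)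
open import Relation.Nullary using (¬_; ¬?; contradiction)
open import Relation.Unary using (Decidable)
open import Relation.Binary.PropositionalEquality
open import Relation.Binary.Definitions using (DecidableEquality; tri<; tri≈; tri>)
open import Function using (_∘_; id)
open import Function.Bundles using (_⇔_; mk⇔; Injection)
open import Function.Definitions using (Injective)
open import Function.Properties.Inverse using (↔⇒↣)
open import Function.Construct.Composition using (_⇔-∘_)

module _ {a} {A : Set a} (_≟ᴬ_ : DecidableEquality A) where

  deduplicate-unique : ∀ {xs} → Unique xs → deduplicate _≟ᴬ_ xs ≡ xs
  deduplicate-unique [] = refl
  deduplicate-unique {x ∷ xs} (x∉xs ∷ xs!) rewrite deduplicate-unique xs! =
    cong (x ∷_) (filter-all (¬? ∘ (x ≟ᴬ_)) x∉xs)

  length-deduplicate≡⇒unique : ∀ xs → length (deduplicate _≟ᴬ_ xs) ≡ length xs → Unique xs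
  length-deduplicate≡⇒unique [] _ = []
  length-deduplicate≡⇒unique (x ∷ xs) eq = All.tabulate x∉xs ∷ length-deduplicate≡⇒unique xs eq′
    where
      P? : Decidable (x ≢_)
      P? = ¬? ∘ (x ≟ᴬ_)
      ys : List A
      ys = deduplicate _≟ᴬ_ xs
      eq-filter : length (filter P? ys) ≡ length xs
      eq-filter = suc-injective eq
      eq′ : length ys ≡ length xs
      eq′ = ≤-antisym (length-deduplicate _≟ᴬ_ xs)
              (subst (_≤ length ys) eq-filter (length-filter P? ys))
      filter-id : filter P? ys ≡ ys
      filter-id = filter-complete P? (trans eq-filter (sym eq′))
      x∉xs : ∀ {y} → y ∈ xs → ¬ (x ≡ y)
      x∉xs y∈xs = proj₂ (∈-filter⁻ P? {xs = ys} (subst (_ ∈_) (sym filter-id) (∈-deduplicate⁺ _≟ᴬ_ y∈xs)))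

tabulate-unique⇒injective : ∀ {a} {A : Set a} {n} {f : Fin n → A} → Unique (tabulate f) → Injective _≡_ _≡_ f
tabulate-unique⇒injective _ {Fin.zero} {Fin.zero} _ = refl
tabulate-unique⇒injective (f₀∉ ∷ _) {Fin.zero} {Fin.suc j} e = contradiction e (Allₚ.tabulate⁻ f₀∉ j)
tabulate-unique⇒injective (f₀∉ ∷ _) {Fin.suc i} {Fin.zero} e = contradiction (sym e) (Allₚ.tabulate⁻ f₀∉ i)
tabulate-unique⇒injective (_ ∷ rest) {Fin.suc i} {Fin.suc j} e = cong Fin.suc (tabulate-unique⇒injective rest e)

Adjacent : ℕ → ℕ → Set
Adjacent a b = b ≡ suc a ⊎ a ≡ suc b

relabel-< : ∀ {v x} → x < v → relabel v x ≡ x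
relabel-< {v} {x} x<v with x <ᵇ v | <⇒<ᵇ x<v
... | true | _ = refl

relabel-≥ : ∀ {v x} → v ≤ x → relabel v x ≡ x ∸ 1
relabel-≥ {v} {x} v≤x with x <ᵇ v in eq
... | true  = contradiction v≤x (<⇒≱ (<ᵇ⇒< x v (subst T (sym eq) tt)))
... | false = refl

relabel-≡∨≡pred : ∀ v x → relabel v x ≡ x ⊎ relabel v x ≡ x ∸ 1
relabel-≡∨≡pred v x with x <ᵇ v
... | true  = inj₁ refl
... | false = inj₂ refl

relabel-suc : ∀ {a x} → x ≢ a → relabel a x ≡ relabel (suc a) x
relabel-suc {a} {x} x≢a with <-cmp x a
... | tri< x<a _ _ = trans (relabel-< x<a) (sym (relabel-< (m<n⇒m<1+n x<a)))
... | tri≈ _ x≡a _ = contradiction x≡a x≢a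
... | tri> _ _ a<x = trans (relabel-≥ (<⇒≤ a<x)) (sym (relabel-≥ a<x))

relabel-adjacent : ∀ {a b x} → Adjacent a b → x ≢ a → x ≢ b → relabel a x ≡ relabel b x
relabel-adjacent (inj₁ refl) x≢a _   = relabel-suc x≢a
relabel-adjacent (inj₂ refl) _   x≢b = sym (relabel-suc x≢b)

relabel-adjacent-cross : ∀ {a b} → Adjacent a b → relabel a b ≡ relabel b a
relabel-adjacent-cross {a} (inj₁ refl) = trans (relabel-≥ (n≤1+n a)) (sym (relabel-< (n<1+n a)))
relabel-adjacent-cross {b = b} (inj₂ refl) = trans (relabel-< (n<1+n b)) (sym (relabel-≥ (n≤1+n b)))

relabel-cross⇒adjacent : ∀ {a b c} → c ≢ a → relabel a c ≡ relabel b a → Adjacent a c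
relabel-cross⇒adjacent {a} {b} {c} c≢a e with <-cmp c a | relabel-≡∨≡pred b a
... | tri≈ _ c≡a _ | _ = contradiction c≡a c≢a
... | tri< c<a _ _ | r = inj₂ (below c<a (⊎-map (trans c≡) (trans c≡) r))
  where
    c≡ : c ≡ relabel b a
    c≡ = trans (sym (relabel-< c<a)) e
    below : ∀ {a c} → c < a → c ≡ a ⊎ c ≡ a ∸ 1 → a ≡ suc c
    below c<a (inj₁ refl) = contradiction c<a (<-irrefl refl)
    below {suc _} _ (inj₂ refl) = refl
... | tri> _ _ a<c | r = inj₁ (above a<c (⊎-map (trans c∸1≡) (trans c∸1≡) r))
  where
    c∸1≡ : c ∸ 1 ≡ relabel b a
    c∸1≡ = trans (sym (relabel-≥ (<⇒≤ a<c))) e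
    above : ∀ {a c} → a < c → c ∸ 1 ≡ a ⊎ c ∸ 1 ≡ a ∸ 1 → c ≡ suc a
    above {c = suc _} _ (inj₁ refl) = refl
    above {zero} {suc zero} _ (inj₂ _) = refl
    above {suc _} {suc _} (s≤s a<c) (inj₂ refl) = contradiction a<c (<-irrefl refl)

punchIn-adjacent : ∀ {n} {i j : Fin (suc n)} → toℕ j ≡ suc (toℕ i) → ∀ k →
                   punchIn i k ≡ punchIn j k ⊎ (punchIn i k ≡ j × punchIn j k ≡ i)
punchIn-adjacent {i = Fin.zero}  {Fin.suc Fin.zero} _ Fin.zero     = inj₂ (refl , refl)
punchIn-adjacent {i = Fin.zero}  {Fin.suc Fin.zero} _ (Fin.suc k)  = inj₁ refl
punchIn-adjacent {i = Fin.suc i} {Fin.suc j}        _  Fin.zero    = inj₁ refl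
punchIn-adjacent {i = Fin.suc i} {Fin.suc j}        ji (Fin.suc k) =
  ⊎-map (cong Fin.suc) (λ (e , e′) → cong Fin.suc e , cong Fin.suc e′)
        (punchIn-adjacent (suc-injective ji) k)

punchIn-crossing : ∀ {n} {i j : Fin (suc n)} → toℕ i < toℕ j →
                   ∃ λ k → toℕ (punchIn i k) ≡ suc (toℕ i) × punchIn j k ≡ i
punchIn-crossing {suc n} {Fin.zero}  {Fin.suc _} _ = Fin.zero , refl , refl
punchIn-crossing {suc n} {Fin.suc i} {Fin.suc j} (s≤s i<j) with punchIn-crossing i<j
... | k , e , e′ = Fin.suc k , cong suc e , cong Fin.suc e′

entry : ∀ {n} → S n → Fin n → ℕ
entry p i = toℕ (p ⟨$⟩ʳ i)

entry-injective : ∀ {n} (p : S n) → Injective _≡_ _≡_ (entry p)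
entry-injective p = Injection.injective (↔⇒↣ p) ∘ toℕ-injective

dropAt-tabulate : ∀ {n} (f : Fin (suc n) → ℕ) i → dropAt (toℕ i) (tabulate f) ≡ tabulate (f ∘ punchIn i)
dropAt-tabulate f Fin.zero = refl
dropAt-tabulate {suc n} f (Fin.suc i) = cong (f Fin.zero ∷_) (dropAt-tabulate (f ∘ Fin.suc) i)

module _ {n} (p : S (suc n)) where

  deletion : Fin (suc n) → Fin n → ℕ
  deletion i k = relabel (entry p i) (entry p (punchIn i k))

  deleteEntry-tabulate : ∀ i → deleteEntry p i ≡ tabulate (deletion i)
  deleteEntry-tabulate i = begin
    map (relabel (entry p i)) (dropAt (toℕ i) (map (entry p) (allFin (suc n))))
      ≡⟨ cong (map (relabel (entry p i)) ∘ dropAt (toℕ i)) (map-tabulate id (entry p)) ⟩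
    map (relabel (entry p i)) (dropAt (toℕ i) (tabulate (entry p)))
      ≡⟨ cong (map (relabel (entry p i))) (dropAt-tabulate (entry p) i) ⟩
    map (relabel (entry p i)) (tabulate (entry p ∘ punchIn i))
      ≡⟨ map-tabulate _ _ ⟩
    tabulate (deletion i) ∎
    where open ≡-Reasoning

  deleteEntry-≡⇒≗ : ∀ {i j} → deleteEntry p i ≡ deleteEntry p j → ∀ k → deletion i k ≡ deletion j k
  deleteEntry-≡⇒≗ {i} {j} e =
    tabulate⁻ (≡⇒≋ (trans (sym (deleteEntry-tabulate i)) (trans e (deleteEntry-tabulate j))))

  ≗⇒deleteEntry-≡ : ∀ {i j} → (∀ k → deletion i k ≡ deletion j k) → deleteEntry p i ≡ deleteEntry p j
  ≗⇒deleteEntry-≡ {i} {j} e =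
    trans (deleteEntry-tabulate i) (trans (tabulate-cong e) (sym (deleteEntry-tabulate j)))

  bond⇒deleteEntry-≡ : ∀ {i j} → toℕ j ≡ suc (toℕ i) → Adjacent (entry p i) (entry p j) →
                       deleteEntry p i ≡ deleteEntry p j
  bond⇒deleteEntry-≡ {i} {j} ji adj = ≗⇒deleteEntry-≡ agree
    where
      agree : ∀ k → deletion i k ≡ deletion j k
      agree k with punchIn-adjacent ji k
      ... | inj₁ same = trans
              (relabel-adjacent adj (punchInᵢ≢i i k ∘ entry-injective p)
                                    (punchInᵢ≢i j k ∘ trans (sym same) ∘ entry-injective p))
              (cong (relabel (entry p j) ∘ entry p) same)
      ... | inj₂ (i↦j , j↦i) = begin
        relabel (entry p i) (entry p (punchIn i k)) ≡⟨ cong (relabel (entry p i) ∘ entry p) i↦j ⟩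
        relabel (entry p i) (entry p j)             ≡⟨ relabel-adjacent-cross adj ⟩
        relabel (entry p j) (entry p i)             ≡⟨ cong (relabel (entry p j) ∘ entry p) (sym j↦i) ⟩
        relabel (entry p j) (entry p (punchIn j k)) ∎
        where open ≡-Reasoning

  deleteEntry-≡⇒bond : ∀ {i j} → toℕ i < toℕ j → deleteEntry p i ≡ deleteEntry p j → HasBond p
  deleteEntry-≡⇒bond {i} {j} i<j e with punchIn-crossing i<j
  ... | k , i′≡1+i , j↦i = i , punchIn i k , i′≡1+i ,
    relabel-cross⇒adjacent {b = entry p j} (punchInᵢ≢i i k ∘ entry-injective p)
      (trans (deleteEntry-≡⇒≗ e k) (cong (relabel (entry p j) ∘ entry p) j↦i))

  deleteEntry-injective⇔¬bond : Injective _≡_ _≡_ (deleteEntry p) ⇔ (¬ HasBond p)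
  deleteEntry-injective⇔¬bond = mk⇔ injective⇒¬bond ¬bond⇒injective
    where
      injective⇒¬bond : Injective _≡_ _≡_ (deleteEntry p) → ¬ HasBond p
      injective⇒¬bond inj (i , j , ji , adj) =
        <-irrefl (cong toℕ (inj (bond⇒deleteEntry-≡ ji adj))) (subst (toℕ i <_) (sym ji) (n<1+n (toℕ i)))
      ¬bond⇒injective : ¬ HasBond p → Injective _≡_ _≡_ (deleteEntry p)
      ¬bond⇒injective nb {i} {j} e with <-cmp (toℕ i) (toℕ j)
      ... | tri< i<j _ _ = contradiction (deleteEntry-≡⇒bond i<j e) nb
      ... | tri≈ _ i≡j _ = toℕ-injective i≡j
      ... | tri> _ _ j<i = contradiction (deleteEntry-≡⇒bond j<i (sym e)) nb

length-D₁⇔deleteEntry-injective : ∀ {n} (p : S n) → (length (D₁ p) ≡ n) ⇔ Injective _≡_ _≡_ (deleteEntry p)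
length-D₁⇔deleteEntry-injective {n} p = mk⇔ maximal⇒injective injective⇒maximal
  where
    patterns : List (List ℕ)
    patterns = map (deleteEntry p) (allFin n)
    patterns≡ : patterns ≡ tabulate (deleteEntry p)
    patterns≡ = map-tabulate id (deleteEntry p)
    length-patterns : length patterns ≡ n
    length-patterns = trans (cong length patterns≡) (length-tabulate (deleteEntry p))
    maximal⇒injective : length (D₁ p) ≡ n → Injective _≡_ _≡_ (deleteEntry p)
    maximal⇒injective len = tabulate-unique⇒injective (subst Unique patterns≡
      (length-deduplicate≡⇒unique (≡-dec _≟_) patterns (trans len (sym length-patterns))))
    injective⇒maximal : Injective _≡_ _≡_ (deleteEntry p) → length (D₁ p) ≡ n
    injective⇒maximal inj = trans
      (cong length (deduplicate-unique (≡-dec _≟_) (subst Unique (sym patterns≡) (tabulate⁺ inj))))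
      length-patterns

corollary1 : (n : ℕ) → 2 ≤ n → (p : S n) →
    (length (D₁ p) ≡ n) ⇔ (¬ HasBond p)
corollary1 (suc n) _ p = deleteEntry-injective⇔¬bond p ⇔-∘ length-D₁⇔deleteEntry-injective p
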